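{- Let $M$ be a matroid on $E$ with a real phase structure $\mathcal{E}$ on $\Sigma_M$, and let $\mathcal{M}_{\mathcal{E}}$ be the orientation of $M$ with $\mathcal{E}_{\mathcal{M}_{\mathcal{E}}}=\mathcal{E}$. Let $C$ be a circuit of $M$ and $i\neq j\in C$. Then the signs of the signed circuits with support $C$ of $\mathcal{M}_{\mathcal{E}}$ satisfy $$\gamma(\mathcal{M}_{\mathcal{E}})^C_{ij}=-(-1)^{\varepsilon_i}(-1)^{\varepsilon_j},$$ where $\varepsilon\in\mathcal{E}(\sigma_{\mathcal{F}})$ for $\mathcal{F}$ any chain of flats containing the flat $\mathrm{cl}(C\setminus\{i,j\})$.
   Context: $\mathbb{Z}_2=\mathbb{Z}/2\mathbb{Z}$. Matroid fan: for a loopfree matroid $M$ on $E$, $v_i=-e_i$, $v_I=\sum_{i\in I}v_i$; for each chain of flats $\mathcal{F}=\{\emptyset\subsetneq F_1\subsetneq\dots\subsetneq F_k\subsetneq E\}$, $\sigma_{\mathcal{F}}$ is the cone generated by $v_{F_1},\dots,v_{F_k},v_E,-v_E$; $\Sigma_M$ consists of these cones. If $M$ has loops $L$, $\Sigma_M:=\Sigma_{M/L}\subset\mathbb{R}^{E\setminus L}$. A real phase structure on $\Sigma_M$ (of dimension $d=\mathrm{rk}(M)$) is a map $\mathcal{E}$ from facets to $d$-dimensional affine subspaces of $\mathbb{Z}_2^{E\setminus L}$ such that the tangent space of $\mathcal{E}(\sigma)$ is the mod 2 reduction of the integer points of the span of $\sigma$, and for every codimension one face the affine spaces of the adjacent facets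 form an even covering. $\mathcal{E}$ is extended to all cones by $\mathcal{E}(\tau)=\bigcup_{\sigma\text{ facet}\supseteq\tau}\mathcal{E}(\sigma)$. For an oriented matroid $\mathcal{M}$ (covectors $\mathcal{C}\subseteq\{0,\pm1\}^E$, topes = maximal covectors, $T\setminus F$ = $T$ with coordinates in $F$ zeroed, $\mathcal{T}(\mathcal{F})$ = topes $T$ with $T\setminus F\in\mathcal{C}$ for all flats $F$ in $\mathcal{F}$), the real phase structure $\mathcal{E}_{\mathcal{M}}$ on $\Sigma_{\underline{\mathcal{M}}}$ is $\mathcal{E}_{\mathcal{M}}(\sigma_{\mathcal{F}})=\{\varepsilon:((-1)^{\varepsilon_e})_e\in\mathcal{T}(\mathcal{F})\}$ (for loopfree $\mathcal{M}$; with loops $L$, use $\mathcal{M}\setminus L$); every real phase structure on $\Sigma_M$ is $\mathcal{E}_{\mathcal{M}}$ for a unique orientation $\mathcal{M}$ of $M$. The signed circuits of $\mathcal{M}$ with support $C$ are a pair $\pm X_C\in\{0,\pm1\}^E$ with support $C$, and $\gamma(\mathcal{M})^C_{ij}=(X_C)_i(X_C)_j$ for $i,j\in C$. -}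

module Defs where

open import Data.Nat using (ℕ)
open import Data.Bool using (Bool; true; false)
open import Data.Fin using (Fin)
open import Data.Fin.Subset using (Subset; _∈_; _∉_; _⊂_; _-_; Nonempty)
open import Data.Vec using (lookup; tabulate)
open import Data.List using (List)
import Data.List.Membership.Propositional as LM
open import Data.List.Relation.Unary.All using (All)
open import Data.List.Relation.Unary.Linked using (Linked)
open import Data.Product using (Σ; ∃; _×_; _,_)
open import Data.Sum using (_⊎_)
open import Relation.Nullary using (¬_)
open import Relation.Binary.PropositionalEquality using (_≡_; _≢_)

data Sign : Set where
  0ₛ +ₛ -ₛ : Sign

negₛ : Sign → Sign
negₛ 0ₛ = 0ₛ
negₛ +ₛ = -ₛ
negₛ -ₛ = +ₛ

_·_ : Sign → Sign → Sign
0ₛ · _  = 0ₛ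
+ₛ · y  = y
-ₛ · y  = negₛ y

_∘ₛ_ : Sign → Sign → Sign
0ₛ ∘ₛ y = y
+ₛ ∘ₛ _ = +ₛ
-ₛ ∘ₛ _ = -ₛ

isNonzero : Sign → Bool
isNonzero 0ₛ = false
isNonzero _  = true

-- (-1)^b for b ∈ ℤ/2 = Bool (false = 0, true = 1)
sgn : Bool → Sign
sgn false = +ₛ
sgn true  = -ₛ

SignVec : ℕ → Set
SignVec n = Fin n → Sign

module _ {n : ℕ} where

  zeroV : SignVec n
  zeroV _ = 0ₛ

  negV : SignVec n → SignVec n
  negV X e = negₛ (X e)

  _∘V_ : SignVec n → SignVec n → SignVec n
  (X ∘V Y) e = X e ∘ₛ Y e

  supp : SignVec n → Subset n
  supp X = tabulate (λ e → isNonzero (X e))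

  _∖_ : SignVec n → Subset n → SignVec n
  (T ∖ F) e with lookup F e
  ... | true  = 0ₛ
  ... | false = T e

  Separates : SignVec n → SignVec n → Fin n → Set
  Separates X Y e = (X e ≢ 0ₛ) × (Y e ≡ negₛ (X e))

  _≼_ : SignVec n → SignVec n → Set
  X ≼ Y = ∀ e → (X e ≡ 0ₛ) ⊎ (X e ≡ Y e)

  Orthogonal : SignVec n → SignVec n → Set
  Orthogonal X Y =
    (∀ e → X e · Y e ≡ 0ₛ) ⊎
    Σ (Fin n) (λ e → Σ (Fin n) (λ f → (X e · Y e ≡ +ₛ) × (X f · Y f ≡ -ₛ)))

record OrientedMatroid (n : ℕ) : Set₁ where
  field
    Covector : SignVec n → Set
    V0 : Covector zeroV
    V1 : ∀ X → Covector X → Covector (negV X)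
    V2 : ∀ X Y → Covector X → Covector Y → Covector (X ∘V Y)
    V3 : ∀ X Y → Covector X → Covector Y → ∀ e → Separates X Y e →
         Σ (SignVec n) (λ Z → Covector Z × (Z e ≡ 0ₛ) ×
           (∀ f → ¬ Separates X Y f → Z f ≡ (X ∘V Y) f))

module _ {n : ℕ} (𝓜 : OrientedMatroid n) where
  open OrientedMatroid 𝓜

  IsTope : SignVec n → Set
  IsTope T = Covector T × (∀ Y → Covector Y → T ≼ Y → ∀ e → Y e ≡ T e)

  IsVector : SignVec n → Set
  IsVector X = ∀ Y → Covector Y → Orthogonal X Y

  IsSignedCircuit : SignVec n → Set
  IsSignedCircuit X =
    IsVector X × Nonempty (supp X) ×
    (∀ Y → IsVector Y → Nonempty (supp Y) → ¬ (supp Y ⊂ supp X))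

  -- The underlying matroid M (flats = zero sets of covectors)

  InClosure : Subset n → Fin n → Set
  InClosure A e = ∀ X → Covector X → (∀ a → a ∈ A → X a ≡ 0ₛ) → X e ≡ 0ₛ

  IsClosureOf : Subset n → Subset n → Set
  IsClosureOf A F = ∀ e → (e ∈ F → InClosure A e) × (InClosure A e → e ∈ F)

  Loop : Fin n → Set
  Loop e = InClosure (tabulate (λ _ → false)) e

  IsFlat : Subset n → Set
  IsFlat F = ∀ e → InClosure F e → e ∈ F

  Independent : Subset n → Set
  Independent A = ∀ e → e ∈ A → ¬ InClosure (A - e) e

  IsCircuit : Subset n → Set
  IsCircuit C = ¬ Independent C × (∀ D → D ⊂ C → Independent D)

  -- Chains of flats ∅ ⊊ F₁ ⊊ … ⊊ F_k ⊊ E of M/L (L = loops), encoded by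
  -- the corresponding flats of M, strictly between cl(∅) = L and E.

  ProperFlat : Subset n → Set
  ProperFlat F = IsFlat F × Σ (Fin n) (λ e → e ∈ F × ¬ Loop e)
                          × Σ (Fin n) (λ e → e ∉ F)

  IsChain : List (Subset n) → Set
  IsChain Fs = All ProperFlat Fs × Linked _⊂_ Fs

  -- facets of Σ_M = maximal chains
  IsMaximalChain : List (Subset n) → Set
  IsMaximalChain Fs = IsChain Fs ×
    (∀ Gs → IsChain Gs → (∀ F → F LM.∈ Fs → F LM.∈ Gs) →
            ∀ G → G LM.∈ Gs → G LM.∈ Fs)

  -- the flat cl(A) belongs to the chain Fs (the empty flat of M/L,
  -- i.e. cl(A) = L, belongs to every chain)
  ChainContainsClosure : List (Subset n) → Subset n → Set
  ChainContainsClosure Fs A =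
    (∀ e → InClosure A e → Loop e) ⊎
    Σ (Subset n) (λ F → F LM.∈ Fs × IsClosureOf A F)

  -- Real phase structure ℰ_𝓜 on Σ_M.
  -- On a facet σ_Gs:  ε ∈ ℰ_𝓜(σ_Gs) iff ((-1)^{ε_e})_{e ∉ L} ∈ 𝒯(Gs).
  -- ε ∈ ℤ₂^E; coordinates at loops are irrelevant (unconstrained).

  InPhaseFacet : List (Subset n) → (Fin n → Bool) → Set
  InPhaseFacet Gs ε =
    Σ (SignVec n) (λ T → IsTope T ×
      (∀ e → ¬ Loop e → T e ≡ sgn (ε e)) ×
      (∀ F → F LM.∈ Gs → Covector (T ∖ F)))

  -- extension to all cones: ℰ(σ_Fs) = ⋃ of ℰ(σ) over facets σ ⊇ σ_Fs
  InPhase : List (Subset n) → (Fin n → Bool) → Set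
  InPhase Fs ε =
    Σ (List (Subset n)) (λ Gs → IsMaximalChain Gs ×
      (∀ F → F LM.∈ Fs → F LM.∈ Gs) × InPhaseFacet Gs ε)

{-# OPTIONS --safe #-}
-- A signed circuit X with support C is orthogonal to every covector Y. Take Y to be the
-- tope T of the phase ε with the coordinates in the flat cl(C ∖ {i, j}) of the chain set
-- to 0; this is a covector because cl(C ∖ {i, j}) is in the chain. As C is a circuit,
-- i and j lie outside cl(C ∖ {i, j}), so Y i = (-1)^{ε i}, Y j = (-1)^{ε j}, while Y
-- vanishes on the rest of C. Hence X · Y is supported on {i, j}, and orthogonality
-- forces X i Y i = - X j Y j, i.e. X i X j = - Y i Y j.
module Submission where

open import Defs
open import Data.Nat using (ℕ)
open import Data.Bool using (Bool; true; false)
open import Data.Fin using (Fin; _≟_)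
open import Data.Fin.Subset using (Subset; _∈_; _∉_; _-_)
open import Data.Fin.Subset.Properties using (_∈?_; x∈p∧x≢y⇒x∈p-y; x∈p⇒p-x⊂p; p─x─y≡p─y─x)
open import Data.Vec using (lookup; tabulate)
open import Data.Vec.Properties using ([]=⇒lookup; lookup⇒[]=; lookup∘tabulate)
open import Data.List using (List)
open import Data.Product using (Σ; _×_; _,_; proj₁; proj₂)
open import Data.Sum using (_⊎_; inj₁; inj₂)
open import Function using (_∘_)
open import Relation.Nullary using (¬_; yes; no; contradiction)
open import Relation.Binary.PropositionalEquality
  using (_≡_; _≢_; refl; sym; trans; subst; subst₂; cong; cong₂; module ≡-Reasoning)

·-zeroʳ : ∀ x → x · 0ₛ ≡ 0ₛ
·-zeroʳ 0ₛ = refl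
·-zeroʳ +ₛ = refl
·-zeroʳ -ₛ = refl

·-negʳ : ∀ x y → x · negₛ y ≡ negₛ (x · y)
·-negʳ 0ₛ y = refl
·-negʳ +ₛ y = refl
·-negʳ -ₛ y = refl

·-sgn-cancel : ∀ {x s} a → x · sgn a ≡ s → x ≡ s · sgn a
·-sgn-cancel {x = 0ₛ} a     refl = refl
·-sgn-cancel {x = +ₛ} false refl = refl
·-sgn-cancel {x = +ₛ} true  refl = refl
·-sgn-cancel {x = -ₛ} false refl = refl
·-sgn-cancel {x = -ₛ} true  refl = refl

·-sgn-≢0ₛ : ∀ {x} a → x ≢ 0ₛ → x · sgn a ≢ 0ₛ
·-sgn-≢0ₛ {x} a x≢0 xa≡0 = x≢0 (·-sgn-cancel {x} a xa≡0)

opposite-sgn-products : ∀ p a b → p ≢ 0ₛ →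
  (p · sgn a) · (negₛ p · sgn b) ≡ negₛ (sgn a · sgn b)
opposite-sgn-products 0ₛ _     _     p≢0 = contradiction refl p≢0
opposite-sgn-products +ₛ a     b     _   = ·-negʳ (sgn a) (sgn b)
opposite-sgn-products -ₛ false _     _   = refl
opposite-sgn-products -ₛ true  false _   = refl
opposite-sgn-products -ₛ true  true  _   = refl

·-sgn-opposite : ∀ x y a b → x · sgn a ≢ 0ₛ → y · sgn b ≡ negₛ (x · sgn a) →
  x · y ≡ negₛ (sgn a · sgn b)
·-sgn-opposite x y a b xa≢0 yb≡-xa = begin
  x · y ≡⟨ cong₂ _·_ (·-sgn-cancel {x} a refl) (·-sgn-cancel {y} b yb≡-xa) ⟩
  ((x · sgn a) · sgn a) · (negₛ (x · sgn a) · sgn b) ≡⟨ opposite-sgn-products (x · sgn a) a b xa≢0 ⟩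
  negₛ (sgn a · sgn b) ∎
  where open ≡-Reasoning

module _ {n : ℕ} where

  ∈supp⇒nonzero : ∀ {X : SignVec n} {e} → e ∈ supp X → isNonzero (X e) ≡ true
  ∈supp⇒nonzero {X} {e} e∈X = trans (sym (lookup∘tabulate _ e)) ([]=⇒lookup e∈X)

  ∈supp⇒≢0ₛ : ∀ {X : SignVec n} {e} → e ∈ supp X → X e ≢ 0ₛ
  ∈supp⇒≢0ₛ {X} e∈X Xe≡0 =
    contradiction (trans (sym (cong isNonzero Xe≡0)) (∈supp⇒nonzero {X} e∈X)) λ ()

  nonzero⇒∈supp : ∀ {X : SignVec n} {e} → isNonzero (X e) ≡ true → e ∈ supp X
  nonzero⇒∈supp {X} {e} nz = lookup⇒[]= e (supp X) (trans (lookup∘tabulate _ e) nz)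

  ∉supp⇒≡0ₛ : ∀ {X : SignVec n} {e} → e ∉ supp X → X e ≡ 0ₛ
  ∉supp⇒≡0ₛ {X} {e} e∉X with X e in Xe
  ... | 0ₛ = refl
  ... | +ₛ = contradiction (nonzero⇒∈supp {X} (cong isNonzero Xe)) e∉X
  ... | -ₛ = contradiction (nonzero⇒∈supp {X} (cong isNonzero Xe)) e∉X

  ∖-∈ : ∀ (T : SignVec n) {F e} → e ∈ F → (T ∖ F) e ≡ 0ₛ
  ∖-∈ T {F} {e} e∈F rewrite []=⇒lookup e∈F = refl

  ∖-∉ : ∀ (T : SignVec n) {F e} → e ∉ F → (T ∖ F) e ≡ T e
  ∖-∉ T {F} {e} e∉F with lookup F e in Fe
  ... | true  = contradiction (lookup⇒[]= e F Fe) e∉F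
  ... | false = refl

  ∉-tabulate-false : ∀ {e : Fin n} → e ∉ tabulate (λ _ → false)
  ∉-tabulate-false {e} e∈∅ =
    contradiction (trans (sym (lookup∘tabulate (λ _ → false) e)) ([]=⇒lookup e∈∅)) λ ()

  product-support-in-pair : ∀ {X Y : SignVec n} {i j} →
    (∀ e → e ≢ i → e ≢ j → X e · Y e ≡ 0ₛ) →
    ∀ {e s} → s ≢ 0ₛ → X e · Y e ≡ s → e ≡ i ⊎ e ≡ j
  product-support-in-pair {i = i} {j} vanish {e} s≢0 XYe≡s with e ≟ i | e ≟ j
  ... | yes e≡i | _       = inj₁ e≡i
  ... | no _    | yes e≡j = inj₂ e≡j
  ... | no e≢i  | no e≢j  = contradiction (trans (sym XYe≡s) (vanish e e≢i e≢j)) s≢0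

  orthogonal-opposite-pair : ∀ {X Y : SignVec n} {i j} → Orthogonal X Y →
    X i · Y i ≢ 0ₛ → (∀ e → e ≢ i → e ≢ j → X e · Y e ≡ 0ₛ) →
    X j · Y j ≡ negₛ (X i · Y i)
  orthogonal-opposite-pair (inj₁ all-zero) XYi≢0 _ = contradiction (all-zero _) XYi≢0
  orthogonal-opposite-pair {X} {Y} (inj₂ (e , f , XYe≡+ , XYf≡-)) _ vanish
    with product-support-in-pair {X} {Y} vanish (λ ()) XYe≡+
       | product-support-in-pair {X} {Y} vanish (λ ()) XYf≡-
  ... | inj₁ refl | inj₁ refl = contradiction (trans (sym XYe≡+) XYf≡-) λ ()
  ... | inj₁ refl | inj₂ refl = trans XYf≡- (sym (cong negₛ XYe≡+))
  ... | inj₂ refl | inj₁ refl = trans XYe≡+ (sym (cong negₛ XYf≡-))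
  ... | inj₂ refl | inj₂ refl = contradiction (trans (sym XYe≡+) XYf≡-) λ ()

module _ {n : ℕ} (𝓜 : OrientedMatroid n) where
  open OrientedMatroid 𝓜

  Loop⇒≡0ₛ : ∀ {e Y} → Loop 𝓜 e → Covector Y → Y e ≡ 0ₛ
  Loop⇒≡0ₛ {Y = Y} loop Y-cov = loop Y Y-cov (λ _ a∈∅ → contradiction a∈∅ ∉-tabulate-false)

  ∈⇒InClosure : ∀ {A e} → e ∈ A → InClosure 𝓜 A e
  ∈⇒InClosure {e = e} e∈A _ _ A-vanish = A-vanish e e∈A

  Loop⇒InClosure : ∀ {A e} → Loop 𝓜 e → InClosure 𝓜 A e
  Loop⇒InClosure loop Y Y-cov _ = Loop⇒≡0ₛ loop Y-cov

  circuit-∉closure-minus-pairʳ : ∀ {C i j} → IsCircuit 𝓜 C → i ∈ C → j ∈ C → i ≢ j →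
    ¬ InClosure 𝓜 ((C - i) - j) j
  circuit-∉closure-minus-pairʳ {C} {i} (_ , proper-independent) i∈C j∈C i≢j =
    proper-independent (C - i) (x∈p⇒p-x⊂p i∈C) _ (x∈p∧x≢y⇒x∈p-y j∈C (i≢j ∘ sym))

  circuit-∉closure-minus-pairˡ : ∀ {C i j} → IsCircuit 𝓜 C → i ∈ C → j ∈ C → i ≢ j →
    ¬ InClosure 𝓜 ((C - i) - j) i
  circuit-∉closure-minus-pairˡ {C} {i} {j} circuit i∈C j∈C i≢j =
    subst (λ A → ¬ InClosure 𝓜 A i) (p─x─y≡p─y─x C j i)
      (circuit-∉closure-minus-pairʳ circuit j∈C i∈C (i≢j ∘ sym))

  phase-covector : ∀ {Fs A ε} → ChainContainsClosure 𝓜 Fs A → InPhase 𝓜 Fs ε →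
    Σ (SignVec n) λ Y → Covector Y × (∀ e → e ∈ A → Y e ≡ 0ₛ) ×
                         (∀ e → ¬ InClosure 𝓜 A e → Y e ≡ sgn (ε e))
  phase-covector (inj₁ cl-loops) (_ , _ , _ , T , (T-cov , _) , T-phase , _) =
    T , T-cov , (λ e e∈A → Loop⇒≡0ₛ (cl-loops e (∈⇒InClosure e∈A)) T-cov)
      , (λ e e∉cl → T-phase e (e∉cl ∘ Loop⇒InClosure))
  phase-covector (inj₂ (F , F∈Fs , F≡cl)) (_ , _ , Fs⊆Gs , T , _ , T-phase , T∖-cov) =
    T ∖ F , T∖-cov F (Fs⊆Gs F F∈Fs)
      , (λ e e∈A → ∖-∈ T (proj₂ (F≡cl e) (∈⇒InClosure e∈A)))
      , (λ e e∉cl → trans (∖-∉ T (e∉cl ∘ proj₁ (F≡cl e))) (T-phase e (e∉cl ∘ Loop⇒InClosure)))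

  vector-sign-pair : ∀ {X Y i j} a b → IsVector 𝓜 X → Covector Y →
    (∀ e → e ∈ (supp X - i) - j → Y e ≡ 0ₛ) → i ∈ supp X →
    Y i ≡ sgn a → Y j ≡ sgn b → X i · X j ≡ negₛ (sgn a · sgn b)
  vector-sign-pair {X} {Y} {i} {j} a b X-vec Y-cov Y-vanish i∈X Yi Yj =
    ·-sgn-opposite (X i) (X j) a b Xi·a≢0 (subst₂ (λ s t → X j · t ≡ negₛ (X i · s)) Yi Yj opposite)
    where
    product-vanishes : ∀ e → e ≢ i → e ≢ j → X e · Y e ≡ 0ₛ
    product-vanishes e e≢i e≢j with e ∈? supp X
    ... | yes e∈X = trans (cong (X e ·_) (Y-vanish e (x∈p∧x≢y⇒x∈p-y (x∈p∧x≢y⇒x∈p-y e∈X e≢i) e≢j)))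
                          (·-zeroʳ (X e))
    ... | no e∉X = cong (_· Y e) (∉supp⇒≡0ₛ e∉X)

    Xi·a≢0 : X i · sgn a ≢ 0ₛ
    Xi·a≢0 = ·-sgn-≢0ₛ a (∈supp⇒≢0ₛ i∈X)

    opposite : X j · Y j ≡ negₛ (X i · Y i)
    opposite = orthogonal-opposite-pair {X = X} {Y} (X-vec Y Y-cov)
      (subst (λ s → X i · s ≢ 0ₛ) (sym Yi) Xi·a≢0) product-vanishes

proposition3p25 : ∀ {n : ℕ} (𝓜 : OrientedMatroid n) (C : Subset n) →
    IsCircuit 𝓜 C →
    (i j : Fin n) → i ∈ C → j ∈ C → i ≢ j →
    (Fs : List (Subset n)) → IsChain 𝓜 Fs →
    ChainContainsClosure 𝓜 Fs ((C - i) - j) →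
    (ε : Fin n → Bool) → InPhase 𝓜 Fs ε →
    (X : SignVec n) → IsSignedCircuit 𝓜 X → supp X ≡ C →
    X i · X j ≡ negₛ (sgn (ε i) · sgn (ε j))
proposition3p25 𝓜 _ circuit i j i∈C j∈C i≢j _ _ cl∈Fs ε ε∈ℰ X (X-vec , _) refl
  with Y , Y-cov , Y-vanish , Y-phase ← phase-covector 𝓜 cl∈Fs ε∈ℰ =
  vector-sign-pair 𝓜 (ε i) (ε j) X-vec Y-cov Y-vanish i∈C
    (Y-phase i (circuit-∉closure-minus-pairˡ 𝓜 circuit i∈C j∈C i≢j))
    (Y-phase j (circuit-∉closure-minus-pairʳ 𝓜 circuit i∈C j∈C i≢j))
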